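{- Let $A$ be an $n\times n\times n$ integer hypermatrix such that $\Xi(A)$ is a corner-sum hypermatrix of order $n$. For $i,j\in[n]$ let $L_{ij}=\sum_{k=1}^n kA_{i,j,k}$, let $\rho(A)=\sum_{0\le i,j,k\le n}\Xi(A)_{i,j,k}$, and let $\Sigma(L)_{i,j}=\sum_{a=1}^i\sum_{b=1}^j L_{ab}$. Then \[\rho(A)+\sum_{1\le i,j\le n}\Sigma(L)_{i,j}=\frac{n^2(n+1)^3}{4}.\]
   Context: For an $n\times n\times n$ hypermatrix $A$, its corner-sum $\Xi(A)$ is the $(n+1)\times(n+1)\times(n+1)$ array with $\Xi(A)_{i,j,k}=\sum_{a=1}^i\sum_{b=1}^j\sum_{c=1}^k A_{a,b,c}$ for $i,j,k\in[0,n]$. A corner-sum hypermatrix of order $n$ is an $(n+1)^3$ integer array $C$ indexed by $[0,n]^3$ with $C_{i,j,0}=C_{i,0,j}=C_{0,i,j}=0$ and $C_{i,j,n}=C_{i,n,j}=C_{n,i,j}=ij$ for all $i,j\in[0,n]$, and such that for all $i,j\in[0,n]$, $1\le k\le n$, each of $C_{i,j,k}-C_{i,j,k-1}$, $C_{i,k,j}-C_{i,k-1,j}$, $C_{k,i,j}-C_{k-1,i,j}$ lies in $\{\max(0,i+j-n),\dots,\min(i,j)\}$. (In the paper $A$ is written as an $n\times n$ array whose cell $(i,j)$ holds the formal sum $\sum_k kA_{i,j,k}$, and $L_{ij}$ is its value.) -}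

module Defs where

open import Data.Nat as ℕ using (ℕ; zero; suc; _≤_; _<_; _∸_)
open import Data.Fin using (Fin; fromℕ<)
open import Data.Integer as ℤ using (ℤ; +_; _+_; _*_; _-_)
open import Data.Nat.Properties using (_<?_)
open import Relation.Nullary using (yes; no)
open import Data.Product using (_×_)
open import Relation.Binary.PropositionalEquality using (_≡_)

sum1 : ℕ → (ℕ → ℤ) → ℤ
sum1 zero    f = + 0
sum1 (suc i) f = sum1 i f + f (suc i)

sum0 : ℕ → (ℕ → ℤ) → ℤ
sum0 i f = f 0 + sum1 i f

-- An n×n×n integer hypermatrix, entries indexed by [n] = {1,…,n}
-- (Fin n position a corresponds to index a+1).
Hyper : ℕ → Set
Hyper n = Fin n → Fin n → Fin n → ℤ

-- entry A_{a,b,c} for a,b,c ∈ [1,n]; returns 0 outside that range (never used there)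
entry : ∀ {n} → Hyper n → ℕ → ℕ → ℕ → ℤ
entry {n} A (suc a) (suc b) (suc c) with a <? n | b <? n | c <? n
... | yes p | yes q | yes r = A (fromℕ< p) (fromℕ< q) (fromℕ< r)
... | _ | _ | _ = + 0
entry A _ _ _ = + 0

Ξ : ∀ {n} → Hyper n → ℕ → ℕ → ℕ → ℤ
Ξ A i j k = sum1 i λ a → sum1 j λ b → sum1 k λ c → entry A a b c

InRange : ℕ → ℕ → ℕ → ℤ → Set
InRange n i j d = (+ ((i ℕ.+ j) ∸ n) ℤ.≤ d) × (d ℤ.≤ + (i ℕ.⊓ j))

-- Corner-sum hypermatrix of order n, as an array indexed by [0,n]^3
-- (given as a function ℕ → ℕ → ℕ → ℤ; only values on [0,n]^3 matter).
record IsCornerSum (n : ℕ) (C : ℕ → ℕ → ℕ → ℤ) : Set where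
  field
    zero₃ : ∀ i j → i ≤ n → j ≤ n → C i j 0 ≡ + 0
    zero₂ : ∀ i j → i ≤ n → j ≤ n → C i 0 j ≡ + 0
    zero₁ : ∀ i j → i ≤ n → j ≤ n → C 0 i j ≡ + 0
    full₃ : ∀ i j → i ≤ n → j ≤ n → C i j n ≡ + (i ℕ.* j)
    full₂ : ∀ i j → i ≤ n → j ≤ n → C i n j ≡ + (i ℕ.* j)
    full₁ : ∀ i j → i ≤ n → j ≤ n → C n i j ≡ + (i ℕ.* j)
    step₃ : ∀ i j k → i ≤ n → j ≤ n → 1 ≤ k → k ≤ n →
              InRange n i j (C i j k - C i j (k ∸ 1))
    step₂ : ∀ i j k → i ≤ n → j ≤ n → 1 ≤ k → k ≤ n →
              InRange n i j (C i k j - C i (k ∸ 1) j)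
    step₁ : ∀ i j k → i ≤ n → j ≤ n → 1 ≤ k → k ≤ n →
              InRange n i j (C k i j - C (k ∸ 1) i j)

Lmat : ∀ {n} → Hyper n → ℕ → ℕ → ℤ
Lmat {n} A i j = sum1 n λ k → + k * entry A i j k

ρ : ∀ {n} → Hyper n → ℤ
ρ {n} A = sum0 n λ i → sum0 n λ j → sum0 n λ k → Ξ A i j k

ΣL : ∀ {n} → Hyper n → ℕ → ℕ → ℤ
ΣL A i j = sum1 i λ a → sum1 j λ b → Lmat A a b

module Submission where

-- For fixed (i, j), Abel summation in the k-direction gives
-- Σ_k Ξ(A)_{ijk} + Σ(L)_{ij} = (n + 1) Ξ(A)_{ijn}, and the boundary condition
-- Ξ(A)_{ijn} = ij of a corner-sum hypermatrix makes this (n + 1) ij. Summing over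
-- i, j ∈ [n] gives (n + 1) (n(n + 1)/2)², the terms of ρ(A) with a zero index
-- vanishing.

open import Defs
open import Data.Nat using (ℕ; zero; suc; _≤_; _^_) renaming (_+_ to _+ℕ_; _*_ to _*ℕ_)
open import Data.Nat.Properties using (≤-refl; m≤n⇒m≤1+n)
import Data.Nat.Tactic.RingSolver as ℕ-Solver
open import Data.Integer using (ℤ; +_; _+_; _*_)
open import Data.Integer.Properties using (+-identityˡ; *-zeroʳ; *-distribˡ-+; *-assoc; *-comm; pos-*)
open import Data.Integer.Tactic.RingSolver using (solve-∀)
open import Relation.Binary.PropositionalEquality
  using (_≡_; refl; sym; trans; cong; cong₂; module ≡-Reasoning)

sum1-cong≤ : ∀ m {f g : ℕ → ℤ} → (∀ x → x ≤ m → f x ≡ g x) → sum1 m f ≡ sum1 m g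
sum1-cong≤ zero    f≡g = refl
sum1-cong≤ (suc m) f≡g =
  cong₂ _+_ (sum1-cong≤ m (λ x x≤m → f≡g x (m≤n⇒m≤1+n x≤m))) (f≡g (suc m) ≤-refl)

sum1-cong : ∀ m {f g : ℕ → ℤ} → (∀ x → f x ≡ g x) → sum1 m f ≡ sum1 m g
sum1-cong m f≡g = sum1-cong≤ m (λ x _ → f≡g x)

sum1-zero : ∀ m {f : ℕ → ℤ} → (∀ x → f x ≡ + 0) → sum1 m f ≡ + 0
sum1-zero zero    f≡0 = refl
sum1-zero (suc m) f≡0 = cong₂ _+_ (sum1-zero m f≡0) (f≡0 (suc m))

sum0-zero : ∀ m {f : ℕ → ℤ} → (∀ x → f x ≡ + 0) → sum0 m f ≡ + 0
sum0-zero m f≡0 = cong₂ _+_ (f≡0 0) (sum1-zero m f≡0)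

sum0≡sum1 : ∀ m {f : ℕ → ℤ} → f 0 ≡ + 0 → sum0 m f ≡ sum1 m f
sum0≡sum1 m {f} f0≡0 = trans (cong (_+ sum1 m f) f0≡0) (+-identityˡ (sum1 m f))

sum1-+ : ∀ m (f g : ℕ → ℤ) → sum1 m (λ x → f x + g x) ≡ sum1 m f + sum1 m g
sum1-+ zero    f g = refl
sum1-+ (suc m) f g = begin
  sum1 m (λ x → f x + g x) + (f (suc m) + g (suc m))
    ≡⟨ cong (_+ (f (suc m) + g (suc m))) (sum1-+ m f g) ⟩
  (sum1 m f + sum1 m g) + (f (suc m) + g (suc m))
    ≡⟨ interchange (sum1 m f) (sum1 m g) (f (suc m)) (g (suc m)) ⟩
  (sum1 m f + f (suc m)) + (sum1 m g + g (suc m))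
    ∎
  where
  open ≡-Reasoning
  interchange : ∀ a b c d → (a + b) + (c + d) ≡ (a + c) + (b + d)
  interchange = solve-∀

sum1-*ˡ : ∀ m c (f : ℕ → ℤ) → sum1 m (λ x → c * f x) ≡ c * sum1 m f
sum1-*ˡ zero    c f = sym (*-zeroʳ c)
sum1-*ˡ (suc m) c f =
  trans (cong (_+ c * f (suc m)) (sum1-*ˡ m c f)) (sym (*-distribˡ-+ c (sum1 m f) (f (suc m))))

sum1-comm : ∀ m k (h : ℕ → ℕ → ℤ) →
  sum1 m (λ a → sum1 k (h a)) ≡ sum1 k (λ c → sum1 m (λ a → h a c))
sum1-comm zero    k h = sym (sum1-zero k (λ _ → refl))
sum1-comm (suc m) k h =
  trans (cong (_+ sum1 k (h (suc m))) (sum1-comm m k h))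
        (sym (sum1-+ k (λ c → sum1 m (λ a → h a c)) (h (suc m))))

sum1-*-sum1 : ∀ m k (f g : ℕ → ℤ) →
  sum1 m (λ a → sum1 k (λ b → f a * g b)) ≡ sum1 m f * sum1 k g
sum1-*-sum1 m k f g = begin
  sum1 m (λ a → sum1 k (λ b → f a * g b)) ≡⟨ sum1-cong m (λ a → sum1-*ˡ k (f a) g) ⟩
  sum1 m (λ a → f a * sum1 k g)           ≡⟨ sum1-cong m (λ a → *-comm (f a) (sum1 k g)) ⟩
  sum1 m (λ a → sum1 k g * f a)           ≡⟨ sum1-*ˡ m (sum1 k g) f ⟩
  sum1 k g * sum1 m f                     ≡⟨ *-comm (sum1 k g) (sum1 m f) ⟩
  sum1 m f * sum1 k g                     ∎
  where open ≡-Reasoning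

-- Abel summation: f c occurs m + 1 − c times among the partial sums and c times in the weighted sum.
partialSums+weightedSum : ∀ m (f : ℕ → ℤ) →
  sum1 m (λ k → sum1 k f) + sum1 m (λ k → + k * f k) ≡ + suc m * sum1 m f
partialSums+weightedSum zero    f = refl
partialSums+weightedSum (suc m) f = begin
  (P + (s + y)) + (W + + suc m * y)
    ≡⟨ regroup P W s y (+ suc m) ⟩
  (P + W) + (s + (y + + suc m * y))
    ≡⟨ cong (_+ (s + (y + + suc m * y))) (partialSums+weightedSum m f) ⟩
  + suc m * s + (s + (y + + suc m * y))
    ≡⟨ collect (+ suc m) s y ⟩
  + suc (suc m) * (s + y)
    ∎
  where
  open ≡-Reasoning
  P = sum1 m (λ k → sum1 k f)
  W = sum1 m (λ k → + k * f k)
  s = sum1 m f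
  y = f (suc m)
  regroup : ∀ P W s y p → (P + (s + y)) + (W + p * y) ≡ (P + W) + (s + (y + p * y))
  regroup = solve-∀
  collect : ∀ p s y → p * s + (s + (y + p * y)) ≡ (+ 1 + p) * (s + y)
  collect = solve-∀

gauss : ∀ n → + 2 * sum1 n (λ j → + j) ≡ + n * + suc n
gauss zero    = refl
gauss (suc n) = begin
  + 2 * (T + + suc n)            ≡⟨ *-distribˡ-+ (+ 2) T (+ suc n) ⟩
  + 2 * T + + 2 * + suc n        ≡⟨ cong (_+ + 2 * + suc n) (gauss n) ⟩
  + n * + suc n + + 2 * + suc n  ≡⟨ step (+ n) ⟩
  + suc n * + suc (suc n)        ∎
  where
  open ≡-Reasoning
  T = sum1 n (λ j → + j)
  step : ∀ x → x * (+ 1 + x) + + 2 * (+ 1 + x) ≡ (+ 1 + x) * (+ 2 + x)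
  step = solve-∀

module _ {n : ℕ} (A : Hyper n) where

  sum1-Ξ+ΣL : ∀ i j → sum1 n (Ξ A i j) + ΣL A i j ≡ + suc n * Ξ A i j n
  sum1-Ξ+ΣL i j = begin
    sum1 n (λ k → sum1 i (λ a → sum1 j (λ b → S a b k))) + ΣL A i j
      ≡⟨ cong (_+ ΣL A i j) (trans (sum1-comm n i _) (sum1-cong i (λ a → sum1-comm n j _))) ⟩
    sum1 i (λ a → sum1 j (λ b → sum1 n (S a b))) + ΣL A i j
      ≡⟨ sym (trans (sum1-cong i (λ a → sum1-+ j _ _)) (sum1-+ i _ _)) ⟩
    sum1 i (λ a → sum1 j (λ b → sum1 n (S a b) + Lmat A a b))
      ≡⟨ sum1-cong i (λ a → sum1-cong j (λ b → partialSums+weightedSum n (entry A a b))) ⟩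
    sum1 i (λ a → sum1 j (λ b → + suc n * S a b n))
      ≡⟨ trans (sum1-cong i (λ a → sum1-*ˡ j (+ suc n) _)) (sum1-*ˡ i (+ suc n) _) ⟩
    + suc n * Ξ A i j n
      ∎
    where
    open ≡-Reasoning
    S : ℕ → ℕ → ℕ → ℤ
    S a b k = sum1 k (entry A a b)

  ρ≡sum1³ : ρ A ≡ sum1 n (λ i → sum1 n (λ j → sum1 n (Ξ A i j)))
  ρ≡sum1³ =
    trans (sum0≡sum1 n (sum0-zero n (λ j → sum0-zero n (λ k → refl))))
    (sum1-cong n (λ i →
      trans (sum0≡sum1 n (sum0-zero n (λ k → sum1-zero i (λ a → refl))))
      (sum1-cong n (λ j →
        sum0≡sum1 n (sum1-zero i (λ a → sum1-zero j (λ b → refl)))))))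

  ρ+ΣΣL : ρ A + sum1 n (λ i → sum1 n (ΣL A i)) ≡ sum1 n (λ i → sum1 n (λ j → + suc n * Ξ A i j n))
  ρ+ΣΣL = begin
    ρ A + sum1 n (λ i → sum1 n (ΣL A i))
      ≡⟨ cong (_+ sum1 n (λ i → sum1 n (ΣL A i))) ρ≡sum1³ ⟩
    sum1 n (λ i → sum1 n (λ j → sum1 n (Ξ A i j))) + sum1 n (λ i → sum1 n (ΣL A i))
      ≡⟨ sym (trans (sum1-cong n (λ i → sum1-+ n _ _)) (sum1-+ n _ _)) ⟩
    sum1 n (λ i → sum1 n (λ j → sum1 n (Ξ A i j) + ΣL A i j))
      ≡⟨ sum1-cong n (λ i → sum1-cong n (sum1-Ξ+ΣL i)) ⟩
    sum1 n (λ i → sum1 n (λ j → + suc n * Ξ A i j n))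
      ∎
    where open ≡-Reasoning

sum1²-suc*ij-closedForm : ∀ n →
  + 4 * sum1 n (λ i → sum1 n (λ j → + suc n * + (i *ℕ j))) ≡ + (n *ℕ n *ℕ suc n ^ 3)
sum1²-suc*ij-closedForm n = begin
  + 4 * sum1 n (λ i → sum1 n (λ j → c * + (i *ℕ j)))
    ≡⟨ cong (+ 4 *_) (sum1-cong n (λ i → sum1-cong n (λ j → factor i j))) ⟩
  + 4 * sum1 n (λ i → sum1 n (λ j → (c * + i) * + j))
    ≡⟨ cong (+ 4 *_) (sum1-*-sum1 n n (λ i → c * + i) (λ j → + j)) ⟩
  + 4 * (sum1 n (λ i → c * + i) * T)
    ≡⟨ cong (λ s → + 4 * (s * T)) (sum1-*ˡ n c (λ j → + j)) ⟩
  + 4 * ((c * T) * T)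
    ≡⟨ doubling c T ⟩
  (+ 2 * T) * (+ 2 * T) * c
    ≡⟨ cong (λ t → t * t * c) (gauss n) ⟩
  (+ n * c) * (+ n * c) * c
    ≡⟨ sym (trans (cong +_ (ℕ-cube n)) ℤ-cast) ⟩
  + (n *ℕ n *ℕ suc n ^ 3)
    ∎
  where
  open ≡-Reasoning
  c = + suc n
  T = sum1 n (λ j → + j)
  factor : ∀ i j → c * + (i *ℕ j) ≡ (c * + i) * + j
  factor i j = trans (cong (c *_) (pos-* i j)) (sym (*-assoc c (+ i) (+ j)))
  doubling : ∀ c t → + 4 * ((c * t) * t) ≡ (+ 2 * t) * (+ 2 * t) * c
  doubling = solve-∀
  ℕ-cube : ∀ x → x *ℕ x *ℕ ((1 +ℕ x) *ℕ ((1 +ℕ x) *ℕ ((1 +ℕ x) *ℕ 1)))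
                 ≡ (x *ℕ (1 +ℕ x)) *ℕ (x *ℕ (1 +ℕ x)) *ℕ (1 +ℕ x)
  ℕ-cube = ℕ-Solver.solve-∀
  ℤ-cast : + ((n *ℕ suc n) *ℕ (n *ℕ suc n) *ℕ suc n) ≡ (+ n * c) * (+ n * c) * c
  ℤ-cast = trans (pos-* ((n *ℕ suc n) *ℕ (n *ℕ suc n)) (suc n))
                 (cong (_* c) (trans (pos-* (n *ℕ suc n) (n *ℕ suc n))
                                     (cong₂ _*_ (pos-* n (suc n)) (pos-* n (suc n)))))

mainTheorem5 : (n : ℕ) (A : Hyper n) → IsCornerSum n (Ξ A) →
    + 4 * (ρ A + sum1 n (λ i → sum1 n (λ j → ΣL A i j)))
    ≡ + (n *ℕ n *ℕ (suc n ^ 3))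
mainTheorem5 n A isCornerSum = begin
  + 4 * (ρ A + sum1 n (λ i → sum1 n (λ j → ΣL A i j)))
    ≡⟨ cong (+ 4 *_) (ρ+ΣΣL A) ⟩
  + 4 * sum1 n (λ i → sum1 n (λ j → + suc n * Ξ A i j n))
    ≡⟨ cong (+ 4 *_) (sum1-cong≤ n (λ i i≤n → sum1-cong≤ n (λ j j≤n →
         cong (+ suc n *_) (IsCornerSum.full₃ isCornerSum i j i≤n j≤n)))) ⟩
  + 4 * sum1 n (λ i → sum1 n (λ j → + suc n * + (i *ℕ j)))
    ≡⟨ sum1²-suc*ij-closedForm n ⟩
  + (n *ℕ n *ℕ (suc n ^ 3))
    ∎
  where open ≡-Reasoning
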